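{- For integers $i\ge 1$, $d\ge 0$, let $S(i,d)$ denote the minimum possible number of vertices of a non-empty irreducible induced subgraph of $Q_i$ with minimum degree exactly $d$. Let $n\ge 0$, $d\ge 0$ and let $G=(V,E)$ be a non-empty induced subgraph of $Q_n$ with $\delta(G)=d$. Then either $|V|=2^d$ or $|V|\ge \min_{i=d+1}^{n} S(i,d)$.
   Context: $Q_n$ is the graph with vertex set $\{0,1\}^n$ in which two vertices are adjacent iff they differ in exactly one coordinate; subgraphs are induced by their vertex sets. A subgraph $G\subseteq Q_n$ is irreducible if it is not contained in any subgraph whose vertex set is obtained by fixing one or more coordinates $x_i$ to given values; equivalently, every $(n-1)$-dimensional subcube $\{x: x_i=j\}$ contains a vertex of $G$. Conventions: the minimum of an empty set (e.g. an empty range of $i$, or $S(i,d)$ when no such subgraph exists) is taken to be $+\infty$. -}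

module Defs where

open import Data.Bool using (Bool; true; false; not)
open import Data.Nat using (ℕ; zero; suc; _≤_; _+_)
open import Data.Fin using (Fin)
open import Data.Vec using (Vec; []; _∷_; lookup; updateAt)
open import Data.List using (List; []; _∷_; map; _++_; filter; length; allFin)
open import Data.Product using (Σ; _×_; _,_)
open import Relation.Binary.PropositionalEquality using (_≡_)
open import Relation.Nullary.Decidable using (Dec)
open import Data.Bool.Properties using (_≟_)

Vertex : ℕ → Set
Vertex n = Vec Bool n

-- An induced subgraph of Q_n is given by its vertex set, a decidable
-- (Bool-valued) predicate on Vertex n.
VSet : ℕ → Set
VSet n = Vertex n → Bool

allVertices : (n : ℕ) → List (Vertex n)
allVertices zero = [] ∷ []
allVertices (suc n) = map (true ∷_) (allVertices n) ++ map (false ∷_) (allVertices n)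

card : {n : ℕ} → VSet n → ℕ
card {n} V = length (filter (λ v → V v ≟ true) (allVertices n))

flip : {n : ℕ} → Vertex n → Fin n → Vertex n
flip v i = updateAt v i not

degree : {n : ℕ} → VSet n → Vertex n → ℕ
degree {n} V v = length (filter (λ i → V (flip v i) ≟ true) (allFin n))

_∈V_ : {n : ℕ} → Vertex n → VSet n → Set
v ∈V V = V v ≡ true

NonEmpty : {n : ℕ} → VSet n → Set
NonEmpty {n} V = Σ (Vertex n) λ v → v ∈V V

MinDegree : {n : ℕ} → VSet n → ℕ → Set
MinDegree {n} V d =
  ((v : Vertex n) → v ∈V V → d ≤ degree V v) ×
  Σ (Vertex n) λ v → v ∈V V × degree V v ≡ d

Irreducible : {n : ℕ} → VSet n → Set
Irreducible {n} V = (i : Fin n) (b : Bool) →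
  Σ (Vertex n) λ v → v ∈V V × lookup v i ≡ b

-- "S(i,d) ≤ m": there is a non-empty irreducible subgraph of Q_i with
-- minimum degree exactly d and at most m vertices.  (With min ∅ = ∞,
-- m ≥ S(i,d) holds iff such a witness exists.)
SAtMost : ℕ → ℕ → ℕ → Set
SAtMost i d m = Σ (VSet i) λ H →
  NonEmpty H × Irreducible H × MinDegree H d × card H ≤ m

-- Let V ⊆ Q_n be non-empty with minimum degree d ≤ n.
--   * d = n: every vertex of V has all its neighbours in V, so V is closed
--     under coordinate flips; Q_n being connected, V = Q_n and |V| = 2^d.
--   * d < n and V irreducible: V itself witnesses S(n,d) ≤ |V|.
--   * d < n and V reducible: V lies in a half-cube {x : x_i = c}.  Deleting
--     coordinate i turns V into a subgraph of Q_{n-1} with the same size and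
--     the same degrees, since the neighbour of a vertex across coordinate i
--     is outside V; induction on n finishes the proof.
module Submission where

open import Defs
open import Data.Nat using (ℕ; suc; _≤_; _^_)
open import Data.Product using (Σ; _×_)
open import Data.Sum using (_⊎_)
open import Relation.Binary.PropositionalEquality using (_≡_)

open import Data.Nat using (zero; _+_; _<_)
open import Data.Nat.Properties
  using (+-identityʳ; +-comm; +-commutativeSemigroup; ≤-trans; ≤-refl; ≤-reflexive;
         ≤-antisym; m≤n⇒m<n∨m≡n; n≤1+n)
open import Algebra.Properties.CommutativeSemigroup +-commutativeSemigroup
  using (interchange; x∙yz≈y∙xz)
open import Data.Bool using (Bool; true; false; not)
open import Data.Bool.Properties using (_≟_; not-¬; ¬-not)
open import Data.Fin using (Fin; zero; suc)
open import Data.Vec using ([]; _∷_; lookup; insertAt; removeAt)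
open import Data.Vec.Properties using (insertAt-lookup; insertAt-removeAt)
open import Data.List using (List; []; _∷_; map; _++_; filter; length; allFin; tabulate)
open import Data.List.Properties
  using (length-++; length-map; length-tabulate; map-tabulate; length-filter;
         filter-++; filter-all; filter-none; filter-complete)
open import Data.List.Relation.Unary.All using (universal)
open import Data.List.Membership.Propositional using (_∈_)
open import Data.List.Membership.Propositional.Properties using (∈-filter⁻; ∈-allFin)
open import Data.Product using (_,_; proj₂)
open import Data.Sum using (inj₁; inj₂)
open import Function using (id; _∘_)
open import Relation.Nullary using (Dec; yes; no; ¬_)
open import Relation.Nullary.Decidable using (map′; _×-dec_; _⊎-dec_)
open import Relation.Binary.PropositionalEquality
  using (refl; sym; trans; cong; cong₂; subst; module ≡-Reasoning)

count : {A : Set} → (A → Bool) → List A → ℕ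
count P xs = length (filter (λ a → P a ≟ true) xs)

indicator : Bool → ℕ
indicator true = 1
indicator false = 0

count-∷ : {A : Set} (P : A → Bool) (x : A) (xs : List A) →
  count P (x ∷ xs) ≡ indicator (P x) + count P xs
count-∷ P x xs with P x
... | true = refl
... | false = refl

count-++ : {A : Set} (P : A → Bool) (xs ys : List A) →
  count P (xs ++ ys) ≡ count P xs + count P ys
count-++ P xs ys = trans (cong length (filter-++ (λ a → P a ≟ true) xs ys))
                         (length-++ (filter (λ a → P a ≟ true) xs))

count-map : {A B : Set} (P : B → Bool) (f : A → B) (xs : List A) →
  count P (map f xs) ≡ count (P ∘ f) xs
count-map P f [] = refl
count-map P f (x ∷ xs) = begin
  count P (f x ∷ map f xs)                 ≡⟨ count-∷ P (f x) (map f xs) ⟩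
  indicator (P (f x)) + count P (map f xs) ≡⟨ cong (indicator (P (f x)) +_) (count-map P f xs) ⟩
  indicator (P (f x)) + count (P ∘ f) xs   ≡⟨ sym (count-∷ (P ∘ f) x xs) ⟩
  count (P ∘ f) (x ∷ xs)                   ∎
  where open ≡-Reasoning

count≤length : {A : Set} (P : A → Bool) (xs : List A) → count P xs ≤ length xs
count≤length P = length-filter (λ a → P a ≟ true)

count-none : {A : Set} (P : A → Bool) → (∀ x → P x ≡ false) → (xs : List A) → count P xs ≡ 0
count-none P none xs =
  cong length (filter-none (λ a → P a ≟ true) (universal (λ x → not-¬ (none x)) xs))

count-all : {A : Set} (P : A → Bool) → (∀ x → P x ≡ true) → (xs : List A) →
  count P xs ≡ length xs
count-all P every xs = cong length (filter-all (λ a → P a ≟ true) (universal every xs))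

count-complete : {A : Set} (P : A → Bool) (xs : List A) → count P xs ≡ length xs →
  {x : A} → x ∈ xs → P x ≡ true
count-complete P xs full x∈xs =
  proj₂ (∈-filter⁻ P? {xs = xs} (subst (_ ∈_) (sym (filter-complete P? full)) x∈xs))
  where P? = λ a → P a ≟ true

length-allVertices : (n : ℕ) → length (allVertices n) ≡ 2 ^ n
length-allVertices zero = refl
length-allVertices (suc n) = begin
  length (map (true ∷_) (allVertices n) ++ map (false ∷_) (allVertices n))
    ≡⟨ length-++ (map (true ∷_) (allVertices n)) ⟩
  length (map (true ∷_) (allVertices n)) + length (map (false ∷_) (allVertices n))
    ≡⟨ cong₂ _+_ (length-map (true ∷_) (allVertices n)) (length-map (false ∷_) (allVertices n)) ⟩
  length (allVertices n) + length (allVertices n)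
    ≡⟨ cong (λ k → k + k) (length-allVertices n) ⟩
  2 ^ n + 2 ^ n
    ≡⟨ cong (2 ^ n +_) (sym (+-identityʳ (2 ^ n))) ⟩
  2 ^ n + (2 ^ n + 0) ∎
  where open ≡-Reasoning

card-full : {n : ℕ} (V : VSet n) → (∀ v → v ∈V V) → card V ≡ 2 ^ n
card-full {n} V full = trans (count-all V full (allVertices n)) (length-allVertices n)

slice : {n : ℕ} → VSet (suc n) → Fin (suc n) → Bool → VSet n
slice V i b u = V (insertAt u i b)

card-split-head : {n : ℕ} (V : VSet (suc n)) →
  card V ≡ card (slice V zero true) + card (slice V zero false)
card-split-head {n} V =
  trans (count-++ V (map (true ∷_) (allVertices n)) (map (false ∷_) (allVertices n)))
        (cong₂ _+_ (count-map V (true ∷_) (allVertices n)) (count-map V (false ∷_) (allVertices n)))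

card-split : {n : ℕ} (V : VSet (suc n)) (i : Fin (suc n)) →
  card V ≡ card (slice V i true) + card (slice V i false)
card-split V zero = card-split-head V
card-split {suc n} V (suc i) = begin
  card V
    ≡⟨ card-split-head V ⟩
  card V₁ + card V₀
    ≡⟨ cong₂ _+_ (card-split V₁ i) (card-split V₀ i) ⟩
  (card (slice V₁ i true) + card (slice V₁ i false)) + (card (slice V₀ i true) + card (slice V₀ i false))
    ≡⟨ interchange (card (slice V₁ i true)) _ _ _ ⟩
  (card (slice V₁ i true) + card (slice V₀ i true)) + (card (slice V₁ i false) + card (slice V₀ i false))
    ≡⟨ sym (cong₂ _+_ (card-split-head (slice V (suc i) true)) (card-split-head (slice V (suc i) false))) ⟩
  card (slice V (suc i) true) + card (slice V (suc i) false) ∎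
  where
  open ≡-Reasoning
  V₁ V₀ : VSet (suc n)
  V₁ = slice V zero true
  V₀ = slice V zero false

card-split-at : {n : ℕ} (V : VSet (suc n)) (i : Fin (suc n)) (c : Bool) →
  card V ≡ card (slice V i c) + card (slice V i (not c))
card-split-at V i true = card-split V i
card-split-at V i false = trans (card-split V i) (+-comm (card (slice V i true)) _)

degree≤dim : {n : ℕ} (V : VSet n) (v : Vertex n) → degree V v ≤ n
degree≤dim {n} V v =
  ≤-trans (count≤length (λ k → V (flip v k)) (allFin n)) (≤-reflexive (length-tabulate id))

full-degree⇒neighbours : {n : ℕ} (V : VSet n) (v : Vertex n) → degree V v ≡ n →
  (k : Fin n) → flip v k ∈V V
full-degree⇒neighbours {n} V v full k =
  count-complete (λ j → V (flip v j)) (allFin n) (trans full (sym (length-tabulate id))) (∈-allFin k)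

degree-head : {n : ℕ} (V : VSet (suc n)) (a : Bool) (u : Vertex n) →
  degree V (a ∷ u) ≡ indicator (V (not a ∷ u)) + degree (slice V zero a) u
degree-head {n} V a u = begin
  degree V (a ∷ u)
    ≡⟨ count-∷ P zero (tabulate suc) ⟩
  indicator (V (not a ∷ u)) + count P (tabulate suc)
    ≡⟨ cong (λ ks → indicator (V (not a ∷ u)) + count P ks) (sym (map-tabulate id suc)) ⟩
  indicator (V (not a ∷ u)) + count P (map suc (allFin n))
    ≡⟨ cong (indicator (V (not a ∷ u)) +_) (count-map P suc (allFin n)) ⟩
  indicator (V (not a ∷ u)) + degree (slice V zero a) u ∎
  where
  open ≡-Reasoning
  P : Fin (suc n) → Bool
  P k = V (flip (a ∷ u) k)

degree-split : {n : ℕ} (V : VSet (suc n)) (i : Fin (suc n)) (c : Bool) (u : Vertex n) →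
  degree V (insertAt u i c) ≡ indicator (V (insertAt u i (not c))) + degree (slice V i c) u
degree-split V zero c u = degree-head V c u
degree-split {suc n} V (suc i) c (a ∷ u) = begin
  degree V (a ∷ insertAt u i c)
    ≡⟨ degree-head V a (insertAt u i c) ⟩
  indicator (V (not a ∷ insertAt u i c)) + degree (slice V zero a) (insertAt u i c)
    ≡⟨ cong (indicator (V (not a ∷ insertAt u i c)) +_) (degree-split (slice V zero a) i c u) ⟩
  indicator (V (not a ∷ insertAt u i c)) + (indicator (V (a ∷ insertAt u i (not c))) + degree (slice (slice V zero a) i c) u)
    ≡⟨ x∙yz≈y∙xz (indicator (V (not a ∷ insertAt u i c))) (indicator (V (a ∷ insertAt u i (not c))))
                 (degree (slice (slice V zero a) i c) u) ⟩
  indicator (V (a ∷ insertAt u i (not c))) + (indicator (V (not a ∷ insertAt u i c)) + degree (slice (slice V zero a) i c) u)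
    ≡⟨ cong (indicator (V (a ∷ insertAt u i (not c))) +_) (sym (degree-head (slice V (suc i) c) a u)) ⟩
  indicator (V (a ∷ insertAt u i (not c))) + degree (slice V (suc i) c) (a ∷ u) ∎
  where open ≡-Reasoning

flip-closed⇒full : {n : ℕ} (V : VSet n) → ((v : Vertex n) → v ∈V V → (k : Fin n) → flip v k ∈V V) →
  (v w : Vertex n) → v ∈V V → w ∈V V
flip-closed⇒full V closed [] [] v∈V = v∈V
flip-closed⇒full V closed (a ∷ v) (b ∷ w) av∈V =
  flip-closed⇒full (slice V zero b) (λ u u∈V k → closed (b ∷ u) u∈V (suc k)) v w (move-head a b av∈V)
  where
  move-head : (a b : Bool) → (a ∷ v) ∈V V → (b ∷ v) ∈V V
  move-head true true h = h
  move-head false false h = h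
  move-head true false h = closed (true ∷ v) h zero
  move-head false true h = closed (false ∷ v) h zero

minDegree≤dim : {n d : ℕ} (V : VSet n) → MinDegree V d → d ≤ n
minDegree≤dim V (_ , v , _ , deg≡d) = subst (_≤ _) deg≡d (degree≤dim V v)

maxMinDegree⇒card : {n : ℕ} (V : VSet n) → MinDegree V n → card V ≡ 2 ^ n
maxMinDegree⇒card V (lower , v₁ , v₁∈V , _) = card-full V (λ w → flip-closed⇒full V closed v₁ w v₁∈V)
  where
  closed : (v : Vertex _) → v ∈V V → (k : Fin _) → flip v k ∈V V
  closed v v∈V = full-degree⇒neighbours V v (≤-antisym (degree≤dim V v) (lower v v∈V))

cube-or-lowDegree : {n d : ℕ} (V : VSet n) → MinDegree V d → card V ≡ 2 ^ d ⊎ d < n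
cube-or-lowDegree V md with m≤n⇒m<n∨m≡n (minDegree≤dim V md)
... | inj₁ d<n = inj₂ d<n
... | inj₂ refl = inj₁ (maxMinDegree⇒card V md)

InSubcube : {n : ℕ} → VSet n → Fin n → Bool → Set
InSubcube {n} V i c = (v : Vertex n) → v ∈V V → lookup v i ≡ c

any-vertex? : {n : ℕ} {P : Vertex n → Set} → ((v : Vertex n) → Dec (P v)) → Dec (Σ (Vertex n) P)
any-vertex? {zero} P? = map′ ([] ,_) (λ { ([] , p) → p }) (P? [])
any-vertex? {suc n} P? =
  map′ (λ { (inj₁ (u , p)) → true ∷ u , p ; (inj₂ (u , p)) → false ∷ u , p })
       (λ { (true ∷ u , p) → inj₁ (u , p) ; (false ∷ u , p) → inj₂ (u , p) })
       (any-vertex? (λ u → P? (true ∷ u)) ⊎-dec any-vertex? (λ u → P? (false ∷ u)))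

all-or-counterexample : {n : ℕ} {A B : Fin n → Set} → ((i : Fin n) → A i ⊎ B i) →
  ((i : Fin n) → A i) ⊎ Σ (Fin n) B
all-or-counterexample {zero} choice = inj₁ λ ()
all-or-counterexample {suc n} choice with choice zero
... | inj₂ b = inj₂ (zero , b)
... | inj₁ a with all-or-counterexample (choice ∘ suc)
...   | inj₁ as = inj₁ λ { zero → a ; (suc i) → as i }
...   | inj₂ (i , b) = inj₂ (suc i , b)

avoids⇒inSubcube : {n : ℕ} (V : VSet n) (i : Fin n) (b : Bool) →
  ¬ (Σ (Vertex n) λ v → v ∈V V × lookup v i ≡ b) → InSubcube V i (not b)
avoids⇒inSubcube V i b avoids v v∈V = ¬-not λ vᵢ≡b → avoids (v , v∈V , vᵢ≡b)

-- Every V is irreducible or lies in a half-cube; decidable since Q_n is finite.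
irreducible-or-inSubcube : {n : ℕ} (V : VSet n) →
  Irreducible V ⊎ Σ (Fin n) λ i → Σ Bool λ c → InSubcube V i c
irreducible-or-inSubcube V = all-or-counterexample coordinate
  where
  meets? : ∀ i b → Dec (Σ (Vertex _) λ v → v ∈V V × lookup v i ≡ b)
  meets? i b = any-vertex? λ v → (V v ≟ true) ×-dec (lookup v i ≟ b)
  coordinate : ∀ i → ((b : Bool) → Σ (Vertex _) λ v → v ∈V V × lookup v i ≡ b) ⊎
                     Σ Bool (InSubcube V i)
  coordinate i with meets? i true | meets? i false
  ... | yes t | yes f = inj₁ λ { true → t ; false → f }
  ... | no ¬t | _ = inj₂ (false , avoids⇒inSubcube V i true ¬t)
  ... | _ | no ¬f = inj₂ (true , avoids⇒inSubcube V i false ¬f)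

module _ {m : ℕ} {V : VSet (suc m)} {i : Fin (suc m)} {c : Bool} (inside : InSubcube V i c) where

  opposite-slice-empty : (u : Vertex m) → slice V i (not c) u ≡ false
  opposite-slice-empty u = ¬-not λ u∈V → not-¬ (inside _ u∈V) (insertAt-lookup u i (not c))

  card-slice : card (slice V i c) ≡ card V
  card-slice = sym (begin
    card V                                             ≡⟨ card-split-at V i c ⟩
    card (slice V i c) + card (slice V i (not c))      ≡⟨ cong (card (slice V i c) +_)
                                                             (count-none _ opposite-slice-empty (allVertices m)) ⟩
    card (slice V i c) + 0                             ≡⟨ +-identityʳ _ ⟩
    card (slice V i c)                                 ∎)
    where open ≡-Reasoning

  -- Degrees are unchanged: the neighbour across coordinate i is never in V.
  degree-slice : (u : Vertex m) → degree (slice V i c) u ≡ degree V (insertAt u i c)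
  degree-slice u =
    sym (trans (degree-split V i c u) (cong (λ b → indicator b + degree (slice V i c) u) (opposite-slice-empty u)))

  restore : (v : Vertex (suc m)) → v ∈V V → insertAt (removeAt v i) i c ≡ v
  restore v v∈V = trans (cong (insertAt (removeAt v i) i) (sym (inside v v∈V))) (insertAt-removeAt v i)

  restrict : (v : Vertex (suc m)) → v ∈V V → removeAt v i ∈V slice V i c
  restrict v v∈V = subst (_∈V V) (sym (restore v v∈V)) v∈V

  descend : {d : ℕ} → NonEmpty V → MinDegree V d →
    NonEmpty (slice V i c) × MinDegree (slice V i c) d × card (slice V i c) ≡ card V
  descend {d} (v₀ , v₀∈V) (lower , v₁ , v₁∈V , deg≡d) =
    (removeAt v₀ i , restrict v₀ v₀∈V) ,
    ((λ u u∈V → subst (d ≤_) (sym (degree-slice u)) (lower _ u∈V)) ,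
     removeAt v₁ i , restrict v₁ v₁∈V ,
     trans (degree-slice _) (trans (cong (degree V) (restore v₁ v₁∈V)) deg≡d)) ,
    card-slice

CubeOrLarge : (n d : ℕ) → VSet n → Set
CubeOrLarge n d V = card V ≡ 2 ^ d ⊎ Σ ℕ (λ i → suc d ≤ i × i ≤ n × SAtMost i d (card V))

cubeOrLarge-lift : {m n d : ℕ} {V′ : VSet m} {V : VSet n} → m ≤ n → card V′ ≡ card V →
  CubeOrLarge m d V′ → CubeOrLarge n d V
cubeOrLarge-lift m≤n same (inj₁ cube) = inj₁ (trans (sym same) cube)
cubeOrLarge-lift m≤n same (inj₂ (i , d<i , i≤m , H , witness)) =
  inj₂ (i , d<i , ≤-trans i≤m m≤n , H , subst (λ k → _ × _ × _ × card H ≤ k) same witness)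

lemma1 : (n d : ℕ) (V : VSet n) → NonEmpty V → MinDegree V d →
    card V ≡ 2 ^ d ⊎
      Σ ℕ (λ i → suc d ≤ i × i ≤ n × SAtMost i d (card V))
lemma1 n d V nonEmpty minDeg with cube-or-lowDegree V minDeg
... | inj₁ cube = inj₁ cube
... | inj₂ d<n with irreducible-or-inSubcube V
...   | inj₁ irreducible = inj₂ (n , d<n , ≤-refl , V , nonEmpty , irreducible , minDeg , ≤-refl)
lemma1 (suc m) d V nonEmpty minDeg | inj₂ d<n | inj₂ (i , c , inside)
  with descend inside nonEmpty minDeg
... | nonEmpty′ , minDeg′ , same =
  cubeOrLarge-lift (n≤1+n m) same (lemma1 m d (slice V i c) nonEmpty′ minDeg′)
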